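{- For every nonnegative integer $n$, \[ \sum_{k=0}^n\binom nk\binom{n+k}k(-1)^{n-k}H_{n+k}=2H_n. \]
   Context: $H_m=\sum_{i=1}^m \frac1i$ denotes the $m$-th harmonic number, with $H_0=0$. -}

module Defs where

open import Data.Nat using (ℕ; zero; suc)
open import Data.Integer using (+_)
open import Data.Rational using (ℚ; 0ℚ; _+_; _/_)

H : ℕ → ℚ
H zero    = 0ℚ
H (suc m) = H m + (+ 1) / suc m

sumTo : ℕ → (ℕ → ℚ) → ℚ
sumTo zero    f = f 0
sumTo (suc n) f = sumTo n f + f (suc n)

module Submission where

-- Proof by the Wilf–Zeilberger method.  Write
--   a(n,k) = (-1)^(n+k) C(n,k) C(n+k,k)      (the coefficient of the theorem,
--                                             since (-1)^(n-k) = (-1)^(n+k)),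
--   r(n,k) = (-1)^(n+k) C(n,k-1) C(n+k,k-1)  (zero for k = 0).
-- Absorption and Pascal's rule give the WZ equation
--   a(n+1,k) - a(n,k) = 2 r(n,k+1) - 2 r(n,k)
-- and its companion (a(n+1,k) - 2 r(n,k+1)) / (n+k+1) = (r(n,k+1) - r(n,k) + 2 a(n,k)) / (n+1).
-- With H(n+k+1) = H(n+k) + 1/(n+k+1) they combine, for F(n,k) = a(n,k) H(n+k), into
--   F(n+1,k) - F(n,k) = (2/(n+1)) a(n,k) + Γ(n,k+1) - Γ(n,k),  Γ(n,k) = r(n,k) (2 H(n+k) + 1/(n+1)).
-- Summing over 0 ≤ k ≤ n+1 telescopes: first Σ_k a(n,k) = 1 for every n, and then
-- Σ_k F(n+1,k) = Σ_k F(n,k) + 2/(n+1), whence Σ_k F(n,k) = 2 H(n) by induction on n.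

open import Defs

-- Binomial identities over ℕ, in a module of their own so that _+_ and _*_ denote
-- the operations on ℕ here and those on ℚ in the rest of the file.
module Binomial where

  open import Data.Nat using (ℕ; zero; suc; _+_; _*_; z≤n; s≤s)
  open import Data.Nat.Properties
    using (+-comm; +-suc; +-identityʳ; +-cancelˡ-≡; *-cancelˡ-≡; *-distribʳ-+; *-distribˡ-+;
           *-zeroʳ; *-identityˡ; *-identityʳ; *-assoc; n<1+n)
  open import Data.Nat.Combinatorics using (_C_; nC1≡n; k>n⇒nCk≡0; nCk+nC[k+1]≡[n+1]C[k+1])
  open import Data.Nat.Tactic.RingSolver using (solve-∀)
  open import Relation.Binary.PropositionalEquality using (_≡_; refl; sym; trans; cong; cong₂)
  open Relation.Binary.PropositionalEquality.≡-Reasoning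

  pascal : ∀ n k → n C k + n C suc k ≡ suc n C suc k
  pascal = nCk+nC[k+1]≡[n+1]C[k+1]

  absorption : ∀ m k → suc k * (suc m C suc k) ≡ suc m * (m C k)
  absorption zero zero = refl
  absorption zero (suc k)
    rewrite k>n⇒nCk≡0 {1} {suc (suc k)} (s≤s (s≤s z≤n)) | k>n⇒nCk≡0 {0} {suc k} (s≤s z≤n) =
    *-zeroʳ (suc (suc k))
  absorption (suc m) zero =
    trans (*-identityˡ _) (trans (nC1≡n (suc (suc m))) (sym (*-identityʳ (suc (suc m)))))
  absorption (suc m) (suc k) = begin
    suc (suc k) * (suc (suc m) C suc (suc k))   ≡⟨ cong (suc (suc k) *_) (sym (pascal (suc m) (suc k))) ⟩
    suc (suc k) * (A + B)                       ≡⟨ distribute A B k ⟩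
    A + (suc k * A + suc (suc k) * B)           ≡⟨ cong₂ (λ p q → A + (p + q)) (absorption m k) (absorption m (suc k)) ⟩
    A + (suc m * (m C k) + suc m * (m C suc k)) ≡⟨ cong (A +_) (*-distribˡ-+ (suc m) (m C k) (m C suc k)) ⟨
    A + suc m * (m C k + m C suc k)             ≡⟨ cong (λ p → A + suc m * p) (pascal m k) ⟩
    suc (suc m) * A                             ∎
    where
    A = suc m C suc k
    B = suc m C suc (suc k)
    distribute : ∀ a b j → (2 + j) * (a + b) ≡ a + ((1 + j) * a + (2 + j) * b)
    distribute = solve-∀

  upperAbsorption : ∀ n k → suc n * (suc (n + k) C k) ≡ suc (n + k) * ((n + k) C k)
  upperAbsorption n zero rewrite +-identityʳ n = refl
  upperAbsorption n (suc j) = +-cancelˡ-≡ (suc M * (M C j)) _ _ (begin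
    suc M * (M C j) + suc n * S            ≡⟨ cong (_+ suc n * S) (sym (absorption M j)) ⟩
    suc j * S + suc n * S                  ≡⟨ *-distribʳ-+ S (suc j) (suc n) ⟨
    (suc j + suc n) * S                    ≡⟨ cong (_* S) (+-comm (suc j) (suc n)) ⟩
    suc M * S                              ≡⟨ cong (suc M *_) (sym (pascal M j)) ⟩
    suc M * (M C j + M C suc j)            ≡⟨ *-distribˡ-+ (suc M) (M C j) (M C suc j) ⟩
    suc M * (M C j) + suc M * (M C suc j)  ∎)
    where
    M = n + suc j
    S = suc M C suc j

  crossRelation : ∀ n j →
    (n C j) * (suc (n + j) C suc j) ≡ (n C suc j) * (suc (n + j) C j) + (n C j) * (suc (n + j) C j)
  crossRelation n j = *-cancelˡ-≡ _ _ (suc j) (begin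
    suc j * (x * Y)                 ≡⟨ swap (suc j) x Y ⟩
    x * (suc j * Y)                 ≡⟨ cong (x *_) (absorption N j) ⟩
    x * (suc N * (N C j))           ≡⟨ cong (x *_) (sym (upperAbsorption n j)) ⟩
    x * (suc n * y)                 ≡⟨ swap x (suc n) y ⟩
    suc n * (x * y)                 ≡⟨ *-assoc (suc n) x y ⟨
    (suc n * x) * y                 ≡⟨ cong (_* y) (sym (absorption n j)) ⟩
    (suc j * (suc n C suc j)) * y   ≡⟨ cong (λ p → (suc j * p) * y) (sym (pascal n j)) ⟩
    (suc j * (x + X)) * y           ≡⟨ expand (suc j) x X y ⟩
    suc j * (X * y + x * y)         ∎)
    where
    N = n + j
    x = n C j
    X = n C suc j
    y = suc N C j
    Y = suc N C suc j
    swap : ∀ a b c → a * (b * c) ≡ b * (a * c)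
    swap = solve-∀
    expand : ∀ c a b d → (c * (a + b)) * d ≡ c * (b * d + a * d)
    expand = solve-∀

  -- The unsigned coefficient C(n,k) C(n+k,k) of the theorem (the coefficients of the
  -- shifted Legendre polynomial of degree n).
  legendre : ℕ → ℕ → ℕ
  legendre n k = (n C k) * ((n + k) C k)

  certificate : ℕ → ℕ → ℕ
  certificate n zero    = 0
  certificate n (suc j) = (n C j) * (suc (n + j) C j)

  certificate-split : ∀ n k →
    (suc n C k) * ((n + k) C k) ≡ certificate n (suc k) + certificate n k
  certificate-split n zero = refl
  certificate-split n (suc j) rewrite +-suc n j = begin
    (suc n C suc j) * Y             ≡⟨ cong (_* Y) (sym (pascal n j)) ⟩
    (x + X) * Y                     ≡⟨ *-distribʳ-+ Y x X ⟩
    x * Y + X * Y                   ≡⟨ cong (_+ X * Y) (crossRelation n j) ⟩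
    (X * y + x * y) + X * Y         ≡⟨ regroup X x y Y ⟩
    X * (y + Y) + x * y             ≡⟨ cong (λ p → X * p + x * y) (pascal (suc (n + j)) j) ⟩
    X * (suc (suc (n + j)) C suc j) + x * y ∎
    where
    x = n C j
    X = n C suc j
    y = suc (n + j) C j
    Y = suc (n + j) C suc j
    regroup : ∀ X x y Y → (X * y + x * y) + X * Y ≡ X * (y + Y) + x * y
    regroup = solve-∀

  legendre-rows : ∀ n k →
    legendre (suc n) k + legendre n k ≡ 2 * ((suc n C k) * ((n + k) C k))
  legendre-rows n zero = refl
  legendre-rows n (suc j) rewrite +-suc n j = begin
    P * (suc (suc N) C suc j) + X * Y  ≡⟨ cong (λ p → P * p + X * Y) (sym (pascal (suc N) j)) ⟩
    P * (y + Y) + X * Y                ≡⟨ cong (λ p → p * (y + Y) + X * Y) (sym (pascal n j)) ⟩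
    (x + X) * (y + Y) + X * Y          ≡⟨ expand x X y Y ⟩
    (X * y + x * y) + (x * Y + 2 * (X * Y)) ≡⟨ cong (_+ (x * Y + 2 * (X * Y))) (crossRelation n j) ⟨
    x * Y + (x * Y + 2 * (X * Y))      ≡⟨ collect x X Y ⟩
    2 * ((x + X) * Y)                  ≡⟨ cong (λ p → 2 * (p * Y)) (pascal n j) ⟩
    2 * (P * Y)                        ∎
    where
    N = n + j
    P = suc n C suc j
    x = n C j
    X = n C suc j
    y = suc N C j
    Y = suc N C suc j
    expand : ∀ x X y Y → (x + X) * (y + Y) + X * Y ≡ (X * y + x * y) + (x * Y + 2 * (X * Y))
    expand = solve-∀
    collect : ∀ x X Y → x * Y + (x * Y + 2 * (X * Y)) ≡ 2 * ((x + X) * Y)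
    collect = solve-∀

  legendre-wz : ∀ n k →
    legendre (suc n) k + legendre n k ≡ 2 * (certificate n (suc k) + certificate n k)
  legendre-wz n k = trans (legendre-rows n k) (cong (2 *_) (certificate-split n k))

  legendre-beyond : ∀ n → legendre n (suc n) ≡ 0
  legendre-beyond n rewrite k>n⇒nCk≡0 (n<1+n n) = refl

  certificate-beyond : ∀ n → certificate n (suc (suc n)) ≡ 0
  certificate-beyond n rewrite k>n⇒nCk≡0 (n<1+n n) = refl

open Binomial
  using (legendre; certificate; upperAbsorption; certificate-split; legendre-wz;
         legendre-beyond; certificate-beyond)

open import Data.Nat using (ℕ; zero; suc; _∸_; _≤_; z≤n; s≤s) renaming (_+_ to _+ℕ_; _*_ to _*ℕ_)
open import Data.Nat.Properties using (+-suc; m≤n⇒m≤1+n; ≤-refl) renaming (+-identityʳ to +ℕ-identityʳ)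
open import Data.Nat.Combinatorics using (_C_)
open import Data.Integer using (ℤ; +_; -_) renaming (_+_ to _+ℤ_; _*_ to _*ℤ_; _^_ to _^ℤ_)
open import Data.Integer.Properties using (pos-*) renaming (*-identityʳ to *ℤ-identityʳ)
open import Data.Rational using (ℚ; 0ℚ; 1ℚ; _+_; _*_; _-_; _/_; toℚᵘ) renaming (-_ to -ℚ_)
open import Data.Rational.Properties
  using (+-*-commutativeRing; +-0-group; _≟_; toℚᵘ-injective; toℚᵘ-fromℚᵘ; toℚᵘ-homo-+; toℚᵘ-homo-*;
         *-identityˡ; *-identityʳ; *-zeroˡ; +-identityʳ)
import Data.Rational.Unnormalised as ℚᵘ
import Data.Rational.Unnormalised.Properties as ℚᵘ
open import Algebra.Properties.Group +-0-group using (⁻¹-involutive)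
open import Relation.Nullary.Decidable using (dec⇒maybe)
open import Relation.Binary.PropositionalEquality using (_≡_; refl; sym; trans; cong; cong₂; module ≡-Reasoning)
open import Tactic.RingSolver using (solve-∀)
import Tactic.RingSolver.Core.AlmostCommutativeRing as ACR
open import Level using (0ℓ)

ℚ-ring : ACR.AlmostCommutativeRing 0ℓ 0ℓ
ℚ-ring = ACR.fromCommutativeRing +-*-commutativeRing (λ q → dec⇒maybe (0ℚ ≟ q))

-- The embeddings ℤ → ℚ and ℕ → ℚ in the form z / 1 used by the theorem; they are ring
-- homomorphisms, which is checked on unnormalised fractions.
fromℤ : ℤ → ℚ
fromℤ z = z / 1

fromℕ : ℕ → ℚ
fromℕ n = fromℤ (+ n)

toℚᵘ-fromℤ : ∀ z → toℚᵘ (fromℤ z) ℚᵘ.≃ ℚᵘ.mkℚᵘ z 0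
toℚᵘ-fromℤ z = toℚᵘ-fromℚᵘ (ℚᵘ.mkℚᵘ z 0)

fromℤ-homo-+ : ∀ z w → fromℤ (z +ℤ w) ≡ fromℤ z + fromℤ w
fromℤ-homo-+ z w = toℚᵘ-injective (begin
  toℚᵘ (fromℤ (z +ℤ w))                  ≈⟨ toℚᵘ-fromℤ (z +ℤ w) ⟩
  ℚᵘ.mkℚᵘ (z +ℤ w) 0                     ≈⟨ ℚᵘ.≃-reflexive (sym (cong₂ (λ a b → ℚᵘ.mkℚᵘ (a +ℤ b) 0) (*ℤ-identityʳ z) (*ℤ-identityʳ w))) ⟩
  ℚᵘ.mkℚᵘ z 0 ℚᵘ.+ ℚᵘ.mkℚᵘ w 0           ≈⟨ ℚᵘ.+-cong (toℚᵘ-fromℤ z) (toℚᵘ-fromℤ w) ⟨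
  toℚᵘ (fromℤ z) ℚᵘ.+ toℚᵘ (fromℤ w)     ≈⟨ toℚᵘ-homo-+ (fromℤ z) (fromℤ w) ⟨
  toℚᵘ (fromℤ z + fromℤ w)               ∎)
  where open ℚᵘ.≃-Reasoning

fromℤ-homo-* : ∀ z w → fromℤ (z *ℤ w) ≡ fromℤ z * fromℤ w
fromℤ-homo-* z w = toℚᵘ-injective (begin
  toℚᵘ (fromℤ (z *ℤ w))                  ≈⟨ toℚᵘ-fromℤ (z *ℤ w) ⟩
  ℚᵘ.mkℚᵘ z 0 ℚᵘ.* ℚᵘ.mkℚᵘ w 0           ≈⟨ ℚᵘ.*-cong (toℚᵘ-fromℤ z) (toℚᵘ-fromℤ w) ⟨
  toℚᵘ (fromℤ z) ℚᵘ.* toℚᵘ (fromℤ w)     ≈⟨ toℚᵘ-homo-* (fromℤ z) (fromℤ w) ⟨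
  toℚᵘ (fromℤ z * fromℤ w)               ∎)
  where open ℚᵘ.≃-Reasoning

fromℕ-homo-+ : ∀ m n → fromℕ (m +ℕ n) ≡ fromℕ m + fromℕ n
fromℕ-homo-+ m n = fromℤ-homo-+ (+ m) (+ n)

fromℕ-homo-* : ∀ m n → fromℕ (m *ℕ n) ≡ fromℕ m * fromℕ n
fromℕ-homo-* m n = trans (cong fromℤ (pos-* m n)) (fromℤ-homo-* (+ m) (+ n))

invSuc : ℕ → ℚ
invSuc m = + 1 / suc m

invSuc-inverse : ∀ m → invSuc m * fromℕ (suc m) ≡ 1ℚ
invSuc-inverse m = toℚᵘ-injective (begin
  toℚᵘ (invSuc m * fromℕ (suc m))             ≈⟨ toℚᵘ-homo-* (invSuc m) (fromℕ (suc m)) ⟩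
  toℚᵘ (invSuc m) ℚᵘ.* toℚᵘ (fromℕ (suc m))   ≈⟨ ℚᵘ.*-cong (toℚᵘ-fromℚᵘ (ℚᵘ.mkℚᵘ (+ 1) m)) (toℚᵘ-fromℤ (+ suc m)) ⟩
  ℚᵘ.mkℚᵘ (+ 1) m ℚᵘ.* ℚᵘ.mkℚᵘ (+ suc m) 0     ≈⟨ ℚᵘ.*-inverseˡ (ℚᵘ.mkℚᵘ (+ suc m) 0) ⟩
  ℚᵘ.1ℚᵘ                                      ∎)
  where open ℚᵘ.≃-Reasoning

ε : ℕ → ℚ
ε zero    = 1ℚ
ε (suc m) = -ℚ ε m

fromℤ-sign : ∀ m → fromℤ ((- (+ 1)) ^ℤ m) ≡ ε m
fromℤ-sign zero    = refl
fromℤ-sign (suc m) = begin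
  fromℤ (- (+ 1) *ℤ (- (+ 1)) ^ℤ m)   ≡⟨ fromℤ-homo-* (- (+ 1)) ((- (+ 1)) ^ℤ m) ⟩
  -ℚ 1ℚ * fromℤ ((- (+ 1)) ^ℤ m)       ≡⟨ cong (-ℚ 1ℚ *_) (fromℤ-sign m) ⟩
  -ℚ 1ℚ * ε m                          ≡⟨ neg-unit (ε m) ⟩
  -ℚ ε m                               ∎
  where
  open ≡-Reasoning
  neg-unit : ∀ q → -ℚ 1ℚ * q ≡ -ℚ q
  neg-unit = solve-∀ ℚ-ring

ε-+suc : ∀ m k → ε (m +ℕ suc k) ≡ -ℚ ε (m +ℕ k)
ε-+suc m k = cong ε (+-suc m k)

ε-parity : ∀ {n k} → k ≤ n → ε (n ∸ k) ≡ ε (n +ℕ k)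
ε-parity {n} z≤n = cong ε (sym (+ℕ-identityʳ n))
ε-parity {suc n} {suc k} (s≤s k≤n) = begin
  ε (n ∸ k)          ≡⟨ ε-parity k≤n ⟩
  ε (n +ℕ k)         ≡⟨ ⁻¹-involutive (ε (n +ℕ k)) ⟨
  -ℚ -ℚ ε (n +ℕ k)   ≡⟨ cong -ℚ_ (ε-+suc n k) ⟨
  -ℚ ε (n +ℕ suc k)  ∎
  where open ≡-Reasoning

-- Dividing an equation (p+1) u = (q+1) v by (p+1)(q+1); this is how the integer
-- identity of upper absorption becomes a statement about 1/(n+1) and 1/(n+k+1).
crossDivide : ∀ p q (u v : ℚ) → fromℕ (suc p) * u ≡ fromℕ (suc q) * v → u * invSuc q ≡ invSuc p * v
crossDivide p q u v eq = begin
  u * invSuc q                               ≡⟨ *-identityˡ _ ⟨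
  1ℚ * (u * invSuc q)                        ≡⟨ cong (_* (u * invSuc q)) (invSuc-inverse p) ⟨
  (invSuc p * fromℕ (suc p)) * (u * invSuc q) ≡⟨ regroup (invSuc p) (fromℕ (suc p)) u (invSuc q) ⟩
  invSuc p * (fromℕ (suc p) * u) * invSuc q  ≡⟨ cong (λ w → invSuc p * w * invSuc q) eq ⟩
  invSuc p * (fromℕ (suc q) * v) * invSuc q  ≡⟨ regroup′ (invSuc p) (fromℕ (suc q)) v (invSuc q) ⟩
  invSuc p * v * (invSuc q * fromℕ (suc q))  ≡⟨ cong (invSuc p * v *_) (invSuc-inverse q) ⟩
  invSuc p * v * 1ℚ                          ≡⟨ *-identityʳ _ ⟩
  invSuc p * v                               ∎
  where
  open ≡-Reasoning
  regroup : ∀ e s u i → (e * s) * (u * i) ≡ e * (s * u) * i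
  regroup = solve-∀ ℚ-ring
  regroup′ : ∀ e s v i → e * (s * v) * i ≡ e * v * (i * s)
  regroup′ = solve-∀ ℚ-ring

coeff : ℕ → ℕ → ℚ
coeff n k = fromℕ (legendre n k) * ε (n +ℕ k)

cert : ℕ → ℕ → ℚ
cert n k = fromℕ (certificate n k) * ε (n +ℕ k)

legendre-wz-ℚ : ∀ n k →
  fromℕ (legendre (suc n) k) + fromℕ (legendre n k)
    ≡ fromℕ 2 * (fromℕ (certificate n (suc k)) + fromℕ (certificate n k))
legendre-wz-ℚ n k = begin
  fromℕ L′ + fromℕ L              ≡⟨ fromℕ-homo-+ L′ L ⟨
  fromℕ (L′ +ℕ L)                 ≡⟨ cong fromℕ (legendre-wz n k) ⟩
  fromℕ (2 *ℕ (ρ₁ +ℕ ρ₀))         ≡⟨ fromℕ-homo-* 2 (ρ₁ +ℕ ρ₀) ⟩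
  fromℕ 2 * fromℕ (ρ₁ +ℕ ρ₀)      ≡⟨ cong (fromℕ 2 *_) (fromℕ-homo-+ ρ₁ ρ₀) ⟩
  fromℕ 2 * (fromℕ ρ₁ + fromℕ ρ₀) ∎
  where
  open ≡-Reasoning
  L′ = legendre (suc n) k
  L = legendre n k
  ρ₁ = certificate n (suc k)
  ρ₀ = certificate n k

-- The WZ equation a(n+1,k) - a(n,k) = 2 r(n,k+1) - 2 r(n,k): the unsigned one times -(-1)^(n+k).
coeff-wz : ∀ n k → coeff (suc n) k ≡ coeff n k + (fromℕ 2 * cert n (suc k) - fromℕ 2 * cert n k)
coeff-wz n k = begin
  coeff (suc n) k                              ≡⟨⟩
  u * -ℚ t                                     ≡⟨ isolate u v t ⟩
  v * t - (u + v) * t                          ≡⟨ cong (λ w → v * t - w * t) (legendre-wz-ℚ n k) ⟩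
  v * t - two * (p + q) * t                    ≡⟨ distribute two t v p q ⟩
  v * t + (two * (p * -ℚ t) - two * (q * t))   ≡⟨ cong (λ s → v * t + (two * (p * s) - two * (q * t))) (ε-+suc n k) ⟨
  coeff n k + (two * cert n (suc k) - two * cert n k) ∎
  where
  open ≡-Reasoning
  two = fromℕ 2
  t = ε (n +ℕ k)
  u = fromℕ (legendre (suc n) k)
  v = fromℕ (legendre n k)
  p = fromℕ (certificate n (suc k))
  q = fromℕ (certificate n k)
  isolate : ∀ u v t → u * -ℚ t ≡ v * t - (u + v) * t
  isolate = solve-∀ ℚ-ring
  distribute : ∀ two t v p q → v * t - two * (p + q) * t ≡ v * t + (two * (p * -ℚ t) - two * (q * t))
  distribute = solve-∀ ℚ-ring

certificate-split-ℚ : ∀ n k →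
  fromℕ (suc n C k) * fromℕ ((n +ℕ k) C k) ≡ fromℕ (n C k) * fromℕ (suc (n +ℕ k) C k) + fromℕ (certificate n k)
certificate-split-ℚ n k = begin
  fromℕ (suc n C k) * fromℕ ((n +ℕ k) C k)          ≡⟨ fromℕ-homo-* (suc n C k) ((n +ℕ k) C k) ⟨
  fromℕ ((suc n C k) *ℕ ((n +ℕ k) C k))             ≡⟨ cong fromℕ (certificate-split n k) ⟩
  fromℕ (certificate n (suc k) +ℕ certificate n k)  ≡⟨ fromℕ-homo-+ (certificate n (suc k)) (certificate n k) ⟩
  fromℕ (certificate n (suc k)) + fromℕ (certificate n k)
    ≡⟨ cong (_+ fromℕ (certificate n k)) (fromℕ-homo-* (n C k) (suc (n +ℕ k) C k)) ⟩
  fromℕ (n C k) * fromℕ (suc (n +ℕ k) C k) + fromℕ (certificate n k) ∎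
  where open ≡-Reasoning

absorption-ratio : ∀ n k →
  fromℕ (suc (n +ℕ k) C k) * invSuc (n +ℕ k) ≡ invSuc n * fromℕ ((n +ℕ k) C k)
absorption-ratio n k = crossDivide n (n +ℕ k) _ _ (begin
  fromℕ (suc n) * fromℕ (suc (n +ℕ k) C k)     ≡⟨ fromℕ-homo-* (suc n) (suc (n +ℕ k) C k) ⟨
  fromℕ (suc n *ℕ (suc (n +ℕ k) C k))          ≡⟨ cong fromℕ (upperAbsorption n k) ⟩
  fromℕ (suc (n +ℕ k) *ℕ ((n +ℕ k) C k))       ≡⟨ fromℕ-homo-* (suc (n +ℕ k)) ((n +ℕ k) C k) ⟩
  fromℕ (suc (n +ℕ k)) * fromℕ ((n +ℕ k) C k)  ∎)
  where open ≡-Reasoning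

-- Both sides equal (-1)^(n+k) (2 C(n,k) - C(n+1,k)) C(n+k,k) / (n+1).
coeff-companion : ∀ n k →
  (coeff (suc n) k - fromℕ 2 * cert n (suc k)) * invSuc (n +ℕ k)
    ≡ invSuc n * ((cert n (suc k) - cert n k) + fromℕ 2 * coeff n k)
coeff-companion n k = begin
  (coeff (suc n) k - two * cert n (suc k)) * E
    ≡⟨ cong₂ (λ u v → (u - two * v) * E) coeff′-unfold cert′-unfold ⟩
  (P * Q′ * -ℚ t - two * (x * Q′ * -ℚ t)) * E   ≡⟨ factor two t x P Q′ E ⟩
  t * (two * x - P) * (Q′ * E)                   ≡⟨ cong (t * (two * x - P) *_) (absorption-ratio n k) ⟩
  t * (two * x - P) * (e * Q)                    ≡⟨ reorder two t x P Q e ⟩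
  e * (t * (two * (x * Q) - P * Q))              ≡⟨ cong (λ w → e * (t * (two * (x * Q) - w))) (certificate-split-ℚ n k) ⟩
  e * (t * (two * (x * Q) - (x * Q′ + ρ₀)))       ≡⟨ expand two t x Q Q′ ρ₀ e ⟩
  e * ((x * Q′ * -ℚ t - ρ₀ * t) + two * (x * Q * t))
    ≡⟨ cong₂ (λ u v → e * ((u - ρ₀ * t) + two * v)) cert′-unfold coeff-unfold ⟨
  e * ((cert n (suc k) - cert n k) + two * coeff n k) ∎
  where
  open ≡-Reasoning
  two = fromℕ 2
  t = ε (n +ℕ k)
  E = invSuc (n +ℕ k)
  e = invSuc n
  x = fromℕ (n C k)
  P = fromℕ (suc n C k)
  Q = fromℕ ((n +ℕ k) C k)
  Q′ = fromℕ (suc (n +ℕ k) C k)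
  ρ₀ = fromℕ (certificate n k)
  coeff′-unfold : coeff (suc n) k ≡ P * Q′ * -ℚ t
  coeff′-unfold = cong (_* -ℚ t) (fromℕ-homo-* (suc n C k) (suc (n +ℕ k) C k))
  coeff-unfold : coeff n k ≡ x * Q * t
  coeff-unfold = cong (_* t) (fromℕ-homo-* (n C k) ((n +ℕ k) C k))
  cert′-unfold : cert n (suc k) ≡ x * Q′ * -ℚ t
  cert′-unfold = cong₂ _*_ (fromℕ-homo-* (n C k) (suc (n +ℕ k) C k)) (ε-+suc n k)
  factor : ∀ two t x P Q′ E → (P * Q′ * -ℚ t - two * (x * Q′ * -ℚ t)) * E ≡ t * (two * x - P) * (Q′ * E)
  factor = solve-∀ ℚ-ring
  reorder : ∀ two t x P Q e → t * (two * x - P) * (e * Q) ≡ e * (t * (two * (x * Q) - P * Q))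
  reorder = solve-∀ ℚ-ring
  expand : ∀ two t x Q Q′ ρ₀ e →
    e * (t * (two * (x * Q) - (x * Q′ + ρ₀))) ≡ e * ((x * Q′ * -ℚ t - ρ₀ * t) + two * (x * Q * t))
  expand = solve-∀ ℚ-ring

term : ℕ → ℕ → ℚ
term n k = coeff n k * H (n +ℕ k)

harmonicCert : ℕ → ℕ → ℚ
harmonicCert n k = cert n k * (fromℕ 2 * H (n +ℕ k) + invSuc n)

term-step : ∀ n k →
  term (suc n) k ≡ (term n k + (fromℕ 2 * invSuc n) * coeff n k) + (harmonicCert n (suc k) - harmonicCert n k)
term-step n k = begin
  term (suc n) k
    ≡⟨⟩
  a′ * (h + E)
    ≡⟨ expand a′ r₁ h E two ⟩
  a′ * h + ((a′ - two * r₁) * E + two * r₁ * E)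
    ≡⟨ cong₂ (λ u v → u * h + (v + two * r₁ * E)) (coeff-wz n k) (coeff-companion n k) ⟩
  (a + (two * r₁ - two * r₀)) * h + (e * ((r₁ - r₀) + two * a) + two * r₁ * E)
    ≡⟨ collect a r₀ r₁ h E e two ⟩
  (a * h + (two * e) * a) + (r₁ * (two * (h + E) + e) - r₀ * (two * h + e))
    ≡⟨ cong (λ m → (a * h + (two * e) * a) + (r₁ * (two * H m + e) - r₀ * (two * h + e))) (+-suc n k) ⟨
  (term n k + (two * e) * a) + (harmonicCert n (suc k) - harmonicCert n k) ∎
  where
  open ≡-Reasoning
  two = fromℕ 2
  a′ = coeff (suc n) k
  a = coeff n k
  r₁ = cert n (suc k)
  r₀ = cert n k
  h = H (n +ℕ k)
  E = invSuc (n +ℕ k)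
  e = invSuc n
  expand : ∀ a′ r₁ h E two → a′ * (h + E) ≡ a′ * h + ((a′ - two * r₁) * E + two * r₁ * E)
  expand = solve-∀ ℚ-ring
  collect : ∀ a r₀ r₁ h E e two →
    (a + (two * r₁ - two * r₀)) * h + (e * ((r₁ - r₀) + two * a) + two * r₁ * E)
      ≡ (a * h + (two * e) * a) + (r₁ * (two * (h + E) + e) - r₀ * (two * h + e))
  collect = solve-∀ ℚ-ring

sumTo-cong : ∀ n {f g : ℕ → ℚ} → (∀ k → k ≤ n → f k ≡ g k) → sumTo n f ≡ sumTo n g
sumTo-cong zero    eq = eq 0 z≤n
sumTo-cong (suc n) eq =
  cong₂ _+_ (sumTo-cong n (λ k k≤n → eq k (m≤n⇒m≤1+n k≤n))) (eq (suc n) ≤-refl)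

sumTo-linear : ∀ n (f g : ℕ → ℚ) c → sumTo n (λ k → f k + c * g k) ≡ sumTo n f + c * sumTo n g
sumTo-linear zero    f g c = refl
sumTo-linear (suc n) f g c =
  trans (cong (_+ (f (suc n) + c * g (suc n))) (sumTo-linear n f g c))
        (regroup (sumTo n f) (sumTo n g) (f (suc n)) (g (suc n)) c)
  where
  regroup : ∀ S T x y c → (S + c * T) + (x + c * y) ≡ (S + x) + c * (T + y)
  regroup = solve-∀ ℚ-ring

sumTo-telescope : ∀ n {f g : ℕ → ℚ} (Γ : ℕ → ℚ) →
  (∀ k → g k ≡ f k + (Γ (suc k) - Γ k)) → sumTo n g ≡ sumTo n f + (Γ (suc n) - Γ 0)
sumTo-telescope zero    Γ eq = eq 0
sumTo-telescope (suc n) {f} Γ eq =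
  trans (cong₂ _+_ (sumTo-telescope n Γ eq) (eq (suc n)))
        (regroup (sumTo n f) (f (suc n)) (Γ 0) (Γ (suc n)) (Γ (suc (suc n))))
  where
  regroup : ∀ S x γ₀ γ₁ γ₂ → (S + (γ₁ - γ₀)) + (x + (γ₂ - γ₁)) ≡ (S + x) + (γ₂ - γ₀)
  regroup = solve-∀ ℚ-ring

sumTo-extend : ∀ n (f : ℕ → ℚ) → f (suc n) ≡ 0ℚ → sumTo (suc n) f ≡ sumTo n f
sumTo-extend n f eq = trans (cong (λ x → sumTo n f + x) eq) (+-identityʳ (sumTo n f))

-- Boundary values: a(n,n+1) = 0, r(n,0) = 0 and r(n,n+2) = 0, so the row sums over
-- 0 ≤ k ≤ n+1 telescope completely.

zero-factor : ∀ {p} q → p ≡ 0ℚ → p * q ≡ 0ℚ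
zero-factor q refl = *-zeroˡ q

coeff-beyond : ∀ n → coeff n (suc n) ≡ 0ℚ
coeff-beyond n = zero-factor _ (cong fromℕ (legendre-beyond n))

cert-zero : ∀ n → cert n 0 ≡ 0ℚ
cert-zero n = zero-factor (ε (n +ℕ 0)) refl

cert-beyond : ∀ n → cert n (suc (suc n)) ≡ 0ℚ
cert-beyond n = zero-factor _ (cong fromℕ (certificate-beyond n))

-- Σ_{k=0}^n (-1)^(n+k) C(n,k) C(n+k,k) = 1: the WZ equation telescopes to equal row sums.
coeff-sum : ∀ n → sumTo n (coeff n) ≡ 1ℚ
coeff-sum zero    = refl
coeff-sum (suc n) = begin
  sumTo (suc n) (coeff (suc n))
    ≡⟨ sumTo-telescope (suc n) (λ k → two * cert n k) (coeff-wz n) ⟩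
  sumTo (suc n) (coeff n) + (two * cert n (suc (suc n)) - two * cert n 0)
    ≡⟨ cong₂ (λ s r → s + (two * r - two * cert n 0)) row (cert-beyond n) ⟩
  1ℚ + (two * 0ℚ - two * cert n 0)
    ≡⟨ cong (λ r → 1ℚ + (two * 0ℚ - two * r)) (cert-zero n) ⟩
  1ℚ + (two * 0ℚ - two * 0ℚ)
    ≡⟨⟩
  1ℚ ∎
  where
  open ≡-Reasoning
  two = fromℕ 2
  row : sumTo (suc n) (coeff n) ≡ 1ℚ
  row = trans (sumTo-extend n (coeff n) (coeff-beyond n)) (coeff-sum n)

-- Σ_{k=0}^n F(n,k) = 2 H(n): the harmonic WZ step adds 2/(n+1) from one row to the next.
harmonic-sum : ∀ n → sumTo n (term n) ≡ fromℕ 2 * H n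
harmonic-sum zero    = refl
harmonic-sum (suc n) = begin
  sumTo (suc n) (term (suc n))
    ≡⟨ sumTo-telescope (suc n) (harmonicCert n) (term-step n) ⟩
  sumTo (suc n) (λ k → term n k + c * coeff n k) + (Γ (suc (suc n)) - Γ 0)
    ≡⟨ cong (_+ (Γ (suc (suc n)) - Γ 0)) (sumTo-linear (suc n) (term n) (coeff n) c) ⟩
  (sumTo (suc n) (term n) + c * sumTo (suc n) (coeff n)) + (Γ (suc (suc n)) - Γ 0)
    ≡⟨ cong₂ (λ s s′ → (s + c * s′) + (Γ (suc (suc n)) - Γ 0)) termRow coeffRow ⟩
  (two * H n + c * 1ℚ) + (Γ (suc (suc n)) - Γ 0)
    ≡⟨ cong₂ (λ u v → (two * H n + c * 1ℚ) + (u - v)) (zero-factor _ (cert-beyond n)) (zero-factor _ (cert-zero n)) ⟩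
  (two * H n + c * 1ℚ) + (0ℚ - 0ℚ)
    ≡⟨ finish two (H n) (invSuc n) ⟩
  two * H (suc n) ∎
  where
  open ≡-Reasoning
  two = fromℕ 2
  c = two * invSuc n
  Γ = harmonicCert n
  termRow : sumTo (suc n) (term n) ≡ two * H n
  termRow = trans (sumTo-extend n (term n) (zero-factor _ (coeff-beyond n))) (harmonic-sum n)
  coeffRow : sumTo (suc n) (coeff n) ≡ 1ℚ
  coeffRow = trans (sumTo-extend n (coeff n) (coeff-beyond n)) (coeff-sum n)
  finish : ∀ two h e → (two * h + (two * e) * 1ℚ) + (0ℚ - 0ℚ) ≡ two * (h + e)
  finish = solve-∀ ℚ-ring

coefficient-cast : ∀ {n k} → k ≤ n →
  (((+ (n C k)) *ℤ (+ ((n +ℕ k) C k))) *ℤ ((- (+ 1)) ^ℤ (n ∸ k))) / 1 ≡ coeff n k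
coefficient-cast {n} {k} k≤n =
  trans (fromℤ-homo-* ((+ (n C k)) *ℤ (+ ((n +ℕ k) C k))) ((- (+ 1)) ^ℤ (n ∸ k)))
        (cong₂ _*_ (cong fromℤ (sym (pos-* (n C k) ((n +ℕ k) C k))))
                   (trans (fromℤ-sign (n ∸ k)) (ε-parity k≤n)))

mainTheorem4 : (n : ℕ) →
    sumTo n (λ k → ((((+ (n C k)) *ℤ (+ ((n +ℕ k) C k))) *ℤ ((- (+ 1)) ^ℤ (n ∸ k))) / 1) * H (n +ℕ k))
      ≡ (+ 2 / 1) * H n
mainTheorem4 n =
  trans (sumTo-cong n (λ k k≤n → cong (_* H (n +ℕ k)) (coefficient-cast k≤n)))
        (harmonic-sum n)
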